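{- Let $\lambda$ be a partition and $n$ a positive integer. The vertices of $P(\lambda,n)$ are exactly the matrices in $M(\lambda,n)$.
   Context: A partition $\lambda=[\lambda_1,\ldots,\lambda_k]$ is a weakly decreasing sequence of positive integers; $a_i$ denotes the number of parts equal to $i$. A sign matrix is a matrix with entries in $\{ -1,0,1\}$ all of whose column partial sums from the top $\sum_{i'=1}^{i}M_{i'j}$ lie in $\{0,1\}$ and all of whose row partial sums from the left $\sum_{j'=1}^{j}M_{ij'}$ are nonnegative. $M(\lambda,n)$ is the set of $\lambda_1\times n$ sign matrices whose $i$-th row sums to $a_{\lambda_1-i+1}$ for each $1\le i\le\lambda_1$, and $P(\lambda,n)$ is its convex hull in $\mathbb{R}^{\lambda_1 n}$.
   Formalization: The convex hull $P(\lambda,n)$ is taken in ℚ^(λ₁×n) rather than $\mathbb{R}^{\lambda_1 n}$, so its points, the candidate vertices and the coefficients of convex combinations are rational. -}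

module Defs where

open import Data.Nat as ℕ using (ℕ; zero; suc; _∸_)
open import Data.Fin using (Fin; zero; suc; toℕ)
open import Data.Integer as ℤ using (ℤ; +_; -[1+_])
open import Data.Rational as ℚ using (ℚ; 0ℚ; 1ℚ; _/_)
open import Data.List using (List; []; _∷_)
open import Data.List.Relation.Unary.All using (All)
open import Data.List.Relation.Unary.Linked using (Linked)
open import Data.Product using (Σ; _×_; _,_; ∃)
open import Data.Sum using (_⊎_)
open import Relation.Binary.PropositionalEquality using (_≡_)
open import Relation.Nullary using (yes; no)

IsPartition : List ℕ → Set
IsPartition λs = Linked ℕ._≥_ λs × All (λ p → 0 ℕ.< p) λs

largestPart : List ℕ → ℕ
largestPart []      = 0
largestPart (p ∷ _) = p

mult : List ℕ → ℕ → ℕ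
mult []       i = 0
mult (p ∷ ps) i with p ℕ.≟ i
... | yes _ = suc (mult ps i)
... | no  _ = mult ps i

Mat : Set → ℕ → ℕ → Set
Mat A m n = Fin m → Fin n → A

sumFirst : ∀ {m} → (Fin m → ℤ) → ℕ → ℤ
sumFirst {zero}  f k       = + 0
sumFirst {suc m} f zero    = + 0
sumFirst {suc m} f (suc k) = f zero ℤ.+ sumFirst (λ i → f (suc i)) k

totalSum : ∀ {m} → (Fin m → ℤ) → ℤ
totalSum {m} f = sumFirst f m

IsSignEntry : ℤ → Set
IsSignEntry x = (x ≡ -[1+ 0 ]) ⊎ (x ≡ + 0) ⊎ (x ≡ + 1)

IsSignMatrix : ∀ {m n} → Mat ℤ m n → Set
IsSignMatrix {m} {n} A =
  (∀ i j → IsSignEntry (A i j))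
  × (∀ (i : Fin m) (j : Fin n) →
       (sumFirst (λ i' → A i' j) (suc (toℕ i)) ≡ + 0)
       ⊎ (sumFirst (λ i' → A i' j) (suc (toℕ i)) ≡ + 1))
  × (∀ (i : Fin m) (j : Fin n) → + 0 ℤ.≤ sumFirst (A i) (suc (toℕ j)))

-- M(λ,n): λ₁ × n sign matrices whose i-th row (1-indexed) sums to
-- a_{λ₁ - i + 1}; with 0-indexed row i this is a_{λ₁ - i}.
InM : (λs : List ℕ) (n : ℕ) → Mat ℤ (largestPart λs) n → Set
InM λs n A =
  IsSignMatrix A
  × (∀ (i : Fin (largestPart λs)) →
       totalSum (A i) ≡ + (mult λs (largestPart λs ∸ toℕ i)))

toℚMat : ∀ {m n} → Mat ℤ m n → Mat ℚ m n
toℚMat A i j = A i j / 1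

_≐_ : ∀ {m n} → Mat ℚ m n → Mat ℚ m n → Set
X ≐ Y = ∀ i j → X i j ≡ Y i j

sumℚ : List ℚ → ℚ
sumℚ []       = 0ℚ
sumℚ (x ∷ xs) = x ℚ.+ sumℚ xs

mapL : {A B : Set} → (A → B) → List A → List B
mapL f []       = []
mapL f (x ∷ xs) = f x ∷ mapL f xs

InConvexHull : ∀ {m n} → (Mat ℚ m n → Set) → Mat ℚ m n → Set
InConvexHull {m} {n} S X =
  Σ (List (ℚ × Mat ℚ m n)) λ cs →
      All (λ { (c , Y) → (0ℚ ℚ.≤ c) × S Y }) cs
    × (sumℚ (mapL (λ { (c , _) → c }) cs) ≡ 1ℚ)
    × (∀ i j → X i j ≡ sumℚ (mapL (λ { (c , Y) → c ℚ.* Y i j }) cs))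

IsVertex : ∀ {m n} → (Mat ℚ m n → Set) → Mat ℚ m n → Set
IsVertex {m} {n} K X =
  K X
  × (∀ (Y Z : Mat ℚ m n) (t : ℚ) → K Y → K Z →
       0ℚ ℚ.< t → t ℚ.< 1ℚ →
       (∀ i j → X i j ≡ t ℚ.* Y i j ℚ.+ (1ℚ ℚ.- t) ℚ.* Z i j) →
       Y ≐ Z)

MSet : (λs : List ℕ) (n : ℕ) → Mat ℚ (largestPart λs) n → Set
MSet λs n X = ∃ λ (A : Mat ℤ (largestPart λs) n) → InM λs n A × (X ≐ toℚMat A)

-- P(λ,n) (its rational points)
P : (λs : List ℕ) (n : ℕ) → Mat ℚ (largestPart λs) n → Set
P λs n = InConvexHull (MSet λs n)

module Submission where

-- Both inclusions are instances of general facts about the convex hull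
-- conv S of a set S of rational m × n matrices (module ConvexHull).
--
-- * A vertex of conv S lies in S.  Write it as a convex combination
--   c Y + (1 - c) Z of the first point Y of a representation and the
--   renormalised rest Z; the vertex property forces Y = Z when 0 < c < 1,
--   the case c = 1 is immediate and c = 0 is handled by induction on the
--   length of the representation.
--
-- * If a family of linear functionals takes only the values 0 and 1 on S
--   and separates points, every point X of S is a vertex of conv S: the
--   functionals are [0,1]-valued on conv S, and 0 and 1 are extreme in
--   [0,1], so X = t Y + (1 - t) Z forces Y and Z to agree under every
--   functional, hence Y = Z.
--
-- For M(λ,n) the functionals are the column partial sums: they lie in
-- {0,1} by the definition of a sign matrix, and the partial sums of a
-- column determine the column.

open import Defs
open import Data.Nat using (ℕ; _<_; zero; suc)
open import Data.Fin using (Fin; zero; suc; toℕ)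
open import Data.Integer as ℤ using (ℤ)
import Data.Integer.Properties as ℤP
open import Data.Rational as ℚ using (ℚ; 0ℚ; 1ℚ; _/_; _+_; _*_; _-_; _≤_; 1/_)
import Data.Rational.Properties as ℚP
open import Algebra.Properties.Group ℚP.+-0-group using (∙-cancelˡ)
import Data.Rational.Unnormalised as ℚᵘ
import Data.Rational.Unnormalised.Properties as ℚᵘP
open import Data.Rational.Solver using (module +-*-Solver)
open +-*-Solver using (solve; _:=_; con; _:+_; _:*_; _:-_)
open import Data.List using (List; []; _∷_)
open import Data.List.Relation.Unary.All as All using (All; []; _∷_)
open import Data.Product using (∃; _×_; _,_; proj₁; proj₂)
open import Data.Sum as Sum using (_⊎_; inj₁; inj₂)
open import Data.Empty using (⊥-elim)
open import Relation.Binary using (tri<; tri≈; tri>)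
open import Relation.Binary.PropositionalEquality
open ≡-Reasoning

ZeroOne : ℚ → Set
ZeroOne x = (x ≡ 0ℚ) ⊎ (x ≡ 1ℚ)

0≤1 : 0ℚ ≤ 1ℚ
0≤1 = ℚP.nonNegative⁻¹ 1ℚ

≤⇒0≤- : ∀ {a b} → a ≤ b → 0ℚ ≤ b - a
≤⇒0≤- {a} {b} a≤b = subst (_≤ b - a) (ℚP.+-inverseʳ a) (ℚP.+-monoˡ-≤ (ℚ.- a) a≤b)

<⇒0<- : ∀ {a b} → a ℚ.< b → 0ℚ ℚ.< b - a
<⇒0<- {a} {b} a<b = subst (ℚ._< b - a) (ℚP.+-inverseʳ a) (ℚP.+-monoˡ-< (ℚ.- a) a<b)

*-nonNeg : ∀ {p q} → 0ℚ ≤ p → 0ℚ ≤ q → 0ℚ ≤ p * q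
*-nonNeg {p} {q} p≥0 q≥0 = ℚP.nonNegative⁻¹ _
  {{ℚP.nonNeg*nonNeg⇒nonNeg p {{ℚ.nonNegative p≥0}} q {{ℚ.nonNegative q≥0}}}}

+-nonNeg : ∀ {p q} → 0ℚ ≤ p → 0ℚ ≤ q → 0ℚ ≤ p + q
+-nonNeg {p} {q} p≥0 q≥0 = subst (_≤ p + q) (ℚP.+-identityʳ 0ℚ) (ℚP.+-mono-≤ p≥0 q≥0)

nonNeg-cases : ∀ {c} → 0ℚ ≤ c → (c ≡ 0ℚ) ⊎ (0ℚ ℚ.< c)
nonNeg-cases {c} c≥0 with ℚP.<-cmp 0ℚ c
... | tri< 0<c _ _ = inj₂ 0<c
... | tri≈ _ 0≡c _ = inj₁ (sym 0≡c)
... | tri> _ _ c<0 = ⊥-elim (ℚP.<-irrefl refl (ℚP.<-≤-trans c<0 c≥0))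

nonNeg-sum-zero : ∀ {p q} → 0ℚ ≤ p → 0ℚ ≤ q → p + q ≡ 0ℚ → p ≡ 0ℚ × q ≡ 0ℚ
nonNeg-sum-zero {p} {q} p≥0 q≥0 p+q≡0 = p≡0 , q≡0
  where
  p≡0 : p ≡ 0ℚ
  p≡0 = ℚP.≤-antisym
    (subst (p ≤_) p+q≡0 (subst (_≤ p + q) (ℚP.+-identityʳ p) (ℚP.+-monoʳ-≤ p q≥0))) p≥0
  q≡0 : q ≡ 0ℚ
  q≡0 = begin
    q       ≡⟨ sym (ℚP.+-identityˡ q) ⟩
    0ℚ + q  ≡⟨ cong (_+ q) (sym p≡0) ⟩
    p + q   ≡⟨ p+q≡0 ⟩
    0ℚ      ∎

pos-*-zero : ∀ {t a} → 0ℚ ℚ.< t → t * a ≡ 0ℚ → a ≡ 0ℚ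
pos-*-zero {t} {a} t>0 ta≡0 = begin
  a               ≡⟨ sym (ℚP.*-identityˡ a) ⟩
  1ℚ * a          ≡⟨ cong (_* a) (sym (ℚP.*-inverseˡ t)) ⟩
  (1/ t * t) * a  ≡⟨ ℚP.*-assoc (1/ t) t a ⟩
  1/ t * (t * a)  ≡⟨ cong (1/ t *_) ta≡0 ⟩
  1/ t * 0ℚ       ≡⟨ ℚP.*-zeroʳ (1/ t) ⟩
  0ℚ              ∎
  where instance
  t≢0 : ℚ.NonZero t
  t≢0 = ℚ.>-nonZero t>0

convex-zero : ∀ {t a b} → 0ℚ ℚ.< t → t ℚ.< 1ℚ → 0ℚ ≤ a → 0ℚ ≤ b →
  t * a + (1ℚ - t) * b ≡ 0ℚ → a ≡ 0ℚ × b ≡ 0ℚ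
convex-zero t>0 t<1 a≥0 b≥0 sum≡0 =
  pos-*-zero t>0 (proj₁ both) , pos-*-zero (<⇒0<- t<1) (proj₂ both)
  where
  both = nonNeg-sum-zero (*-nonNeg (ℚP.<⇒≤ t>0) a≥0)
                         (*-nonNeg (≤⇒0≤- (ℚP.<⇒≤ t<1)) b≥0) sum≡0

zeroOne-extreme : ∀ {t a b v} → 0ℚ ℚ.< t → t ℚ.< 1ℚ →
  0ℚ ≤ a × a ≤ 1ℚ → 0ℚ ≤ b × b ≤ 1ℚ → ZeroOne v →
  v ≡ t * a + (1ℚ - t) * b → a ≡ b
zeroOne-extreme t>0 t<1 (a≥0 , _) (b≥0 , _) (inj₁ refl) v≡ =
  let (a≡0 , b≡0) = convex-zero t>0 t<1 a≥0 b≥0 (sym v≡) in trans a≡0 (sym b≡0)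
zeroOne-extreme {t} {a} {b} t>0 t<1 (_ , a≤1) (_ , b≤1) (inj₂ refl) v≡ = begin
  a              ≡⟨ reflect a ⟩
  1ℚ - (1ℚ - a)  ≡⟨ cong (1ℚ -_) (trans 1-a≡0 (sym 1-b≡0)) ⟩
  1ℚ - (1ℚ - b)  ≡⟨ sym (reflect b) ⟩
  b              ∎
  where
  reflect : ∀ x → x ≡ 1ℚ - (1ℚ - x)
  reflect = solve 1 (λ x → x := con 1ℚ :- (con 1ℚ :- x)) refl
  complement : ∀ t a b →
    t * (1ℚ - a) + (1ℚ - t) * (1ℚ - b) ≡ 1ℚ - (t * a + (1ℚ - t) * b)
  complement = solve 3 (λ t a b →
    t :* (con 1ℚ :- a) :+ (con 1ℚ :- t) :* (con 1ℚ :- b)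
      := con 1ℚ :- (t :* a :+ (con 1ℚ :- t) :* b)) refl
  reflected≡0 : t * (1ℚ - a) + (1ℚ - t) * (1ℚ - b) ≡ 0ℚ
  reflected≡0 = trans (complement t a b)
                      (trans (cong (1ℚ -_) (sym v≡)) (ℚP.+-inverseʳ 1ℚ))
  1-a≡0 = proj₁ (convex-zero t>0 t<1 (≤⇒0≤- a≤1) (≤⇒0≤- b≤1) reflected≡0)
  1-b≡0 = proj₂ (convex-zero t>0 t<1 (≤⇒0≤- a≤1) (≤⇒0≤- b≤1) reflected≡0)

scaled-zeroOne : ∀ {c v} → 0ℚ ≤ c → ZeroOne v → 0ℚ ≤ c * v × c * v ≤ c
scaled-zeroOne {c} c≥0 (inj₁ refl) rewrite ℚP.*-zeroʳ c     = ℚP.≤-refl , c≥0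
scaled-zeroOne {c} c≥0 (inj₂ refl) rewrite ℚP.*-identityʳ c = c≥0 , ℚP.≤-refl

/1-+ : ∀ a b → (a ℤ.+ b) / 1 ≡ a / 1 + b / 1
/1-+ a b = ℚP.toℚᵘ-injective
  (ℚᵘP.≃-trans (ℚP.toℚᵘ-fromℚᵘ (ℚᵘ.mkℚᵘ (a ℤ.+ b) 0))
  (ℚᵘP.≃-trans sum-of-integers
  (ℚᵘP.≃-sym (ℚᵘP.≃-trans (ℚP.toℚᵘ-homo-+ (a / 1) (b / 1))
     (ℚᵘP.+-cong (ℚP.toℚᵘ-fromℚᵘ (ℚᵘ.mkℚᵘ a 0)) (ℚP.toℚᵘ-fromℚᵘ (ℚᵘ.mkℚᵘ b 0)))))))
  where
  sum-of-integers : ℚᵘ.mkℚᵘ (a ℤ.+ b) 0 ℚᵘ.≃ ℚᵘ.mkℚᵘ a 0 ℚᵘ.+ ℚᵘ.mkℚᵘ b 0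
  sum-of-integers = ℚᵘ.*≡* (cong (ℤ._* ℤ.+ 1)
    (sym (cong₂ ℤ._+_ (ℤP.*-identityʳ a) (ℤP.*-identityʳ b))))

zero-combination : ∀ a b → 0ℚ ≡ a * 0ℚ + b * 0ℚ
zero-combination = solve 2 (λ a b → con 0ℚ := a :* con 0ℚ :+ b :* con 0ℚ) refl

prefixSum : ∀ {m} → (Fin m → ℚ) → ℕ → ℚ
prefixSum         f zero    = 0ℚ
prefixSum {zero}  f (suc k) = 0ℚ
prefixSum {suc m} f (suc k) = f zero + prefixSum (λ i → f (suc i)) k

prefixSum-cong : ∀ {m} {f g : Fin m → ℚ} → (∀ i → f i ≡ g i) →
  ∀ k → prefixSum f k ≡ prefixSum g k
prefixSum-cong         f≗g zero    = refl
prefixSum-cong {zero}  f≗g (suc k) = refl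
prefixSum-cong {suc m} f≗g (suc k) =
  cong₂ _+_ (f≗g zero) (prefixSum-cong (λ i → f≗g (suc i)) k)

prefixSum-linear : ∀ {m} a b (f g : Fin m → ℚ) k →
  prefixSum (λ i → a * f i + b * g i) k ≡ a * prefixSum f k + b * prefixSum g k
prefixSum-linear         a b f g zero    = zero-combination a b
prefixSum-linear {zero}  a b f g (suc k) = zero-combination a b
prefixSum-linear {suc m} a b f g (suc k) = begin
  (a * f zero + b * g zero) + prefixSum (λ i → a * f (suc i) + b * g (suc i)) k
    ≡⟨ cong ((a * f zero + b * g zero) +_) (prefixSum-linear a b _ _ k) ⟩
  (a * f zero + b * g zero) + (a * prefixSum f′ k + b * prefixSum g′ k)
    ≡⟨ regroup a b (f zero) (g zero) _ _ ⟩
  a * (f zero + prefixSum f′ k) + b * (g zero + prefixSum g′ k) ∎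
  where
  f′ = λ i → f (suc i)
  g′ = λ i → g (suc i)
  regroup : ∀ a b x y u v →
    (a * x + b * y) + (a * u + b * v) ≡ a * (x + u) + b * (y + v)
  regroup = solve 6 (λ a b x y u v →
    (a :* x :+ b :* y) :+ (a :* u :+ b :* v) := a :* (x :+ u) :+ b :* (y :+ v)) refl

prefixSum-/1 : ∀ {m} (f : Fin m → ℤ) k → prefixSum (λ i → f i / 1) k ≡ sumFirst f k / 1
prefixSum-/1 {zero}  f zero    = refl
prefixSum-/1 {zero}  f (suc k) = refl
prefixSum-/1 {suc m} f zero    = refl
prefixSum-/1 {suc m} f (suc k) =
  trans (cong (f zero / 1 +_) (prefixSum-/1 (λ i → f (suc i)) k))
        (sym (/1-+ (f zero) _))

prefixSums-determine : ∀ {m} (f g : Fin m → ℚ) →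
  (∀ (i : Fin m) → prefixSum f (suc (toℕ i)) ≡ prefixSum g (suc (toℕ i))) →
  ∀ i → f i ≡ g i
prefixSums-determine {suc m} f g same = determine
  where
  heads : f zero ≡ g zero
  heads = begin
    f zero        ≡⟨ sym (ℚP.+-identityʳ (f zero)) ⟩
    f zero + 0ℚ   ≡⟨ same zero ⟩
    g zero + 0ℚ   ≡⟨ ℚP.+-identityʳ (g zero) ⟩
    g zero        ∎
  tails : ∀ (i : Fin m) → prefixSum (λ i → f (suc i)) (suc (toℕ i))
              ≡ prefixSum (λ i → g (suc i)) (suc (toℕ i))
  tails i = ∙-cancelˡ (f zero) _ _ (trans (same (suc i)) (cong (_+ _) (sym heads)))
  determine : ∀ i → f i ≡ g i
  determine zero    = heads
  determine (suc i) = prefixSums-determine (λ i → f (suc i)) (λ i → g (suc i)) tails i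

Term : ℕ → ℕ → Set
Term m n = ℚ × Mat ℚ m n

sumℚ-mapL-cong : {A B : Set} {f g : A × B → ℚ} → (∀ a b → f (a , b) ≡ g (a , b)) →
  ∀ L → sumℚ (mapL f L) ≡ sumℚ (mapL g L)
sumℚ-mapL-cong f≗g []            = refl
sumℚ-mapL-cong f≗g ((a , b) ∷ L) = cong₂ _+_ (f≗g a b) (sumℚ-mapL-cong f≗g L)

record IsLinear {m n : ℕ} (φ : Mat ℚ m n → ℚ) : Set where
  field
    respects-≐ : ∀ {X Y} → X ≐ Y → φ X ≡ φ Y
    linear     : ∀ a b X Y → φ (λ i j → a * X i j + b * Y i j) ≡ a * φ X + b * φ Y

  zero-matrix : φ (λ _ _ → 0ℚ) ≡ 0ℚ
  zero-matrix = begin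
    φ O                                      ≡⟨ respects-≐ (λ i j → zero-combination 0ℚ 0ℚ) ⟩
    φ (λ i j → 0ℚ * O i j + 0ℚ * O i j)      ≡⟨ linear 0ℚ 0ℚ O O ⟩
    0ℚ * φ O + 0ℚ * φ O                      ≡⟨ vanish (φ O) ⟩
    0ℚ                                       ∎
    where
    O : Mat ℚ m n
    O _ _ = 0ℚ
    vanish : ∀ x → 0ℚ * x + 0ℚ * x ≡ 0ℚ
    vanish = solve 1 (λ x → con 0ℚ :* x :+ con 0ℚ :* x := con 0ℚ) refl

module ConvexHull {m n : ℕ} (S : Mat ℚ m n → Set) where

  weight : List (Term m n) → ℚ
  weight L = sumℚ (mapL proj₁ L)

  combination : List (Term m n) → Mat ℚ m n
  combination L i j = sumℚ (mapL (λ t → proj₁ t * proj₂ t i j) L)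

  Admissible : List (Term m n) → Set
  Admissible = All (λ t → 0ℚ ≤ proj₁ t × S (proj₂ t))

  hull⇒combination : ∀ {X} → InConvexHull S X →
    ∃ λ L → Admissible L × weight L ≡ 1ℚ × X ≐ combination L
  hull⇒combination (L , adm , w≡1 , X≐) =
    L , All.map (λ { {c , Y} p → p }) adm ,
    trans (sym (sumℚ-mapL-cong (λ _ _ → refl) L)) w≡1 ,
    λ i j → trans (X≐ i j) (sumℚ-mapL-cong (λ _ _ → refl) L)

  combination⇒hull : ∀ {X} L → Admissible L → weight L ≡ 1ℚ → X ≐ combination L →
    InConvexHull S X
  combination⇒hull L adm w≡1 X≐ =
    L , All.map (λ { {c , Y} p → p }) adm ,
    trans (sumℚ-mapL-cong (λ _ _ → refl) L) w≡1 ,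
    λ i j → trans (X≐ i j) (sumℚ-mapL-cong (λ _ _ → refl) L)

  member⇒hull : ∀ {X} → S X → InConvexHull S X
  member⇒hull {X} X∈S = combination⇒hull ((1ℚ , X) ∷ []) ((0≤1 , X∈S) ∷ [])
    (ℚP.+-identityʳ 1ℚ)
    (λ i j → sym (trans (ℚP.+-identityʳ _) (ℚP.*-identityˡ (X i j))))

  weight-nonNeg : ∀ {L} → Admissible L → 0ℚ ≤ weight L
  weight-nonNeg []                = ℚP.≤-refl
  weight-nonNeg ((c≥0 , _) ∷ adm) = +-nonNeg c≥0 (weight-nonNeg adm)

  zero-weight⇒zero : ∀ {L} → Admissible L → weight L ≡ 0ℚ →
    ∀ i j → combination L i j ≡ 0ℚ
  zero-weight⇒zero []                                w≡0 i j = refl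
  zero-weight⇒zero {(c , Y) ∷ L} ((c≥0 , _) ∷ adm) w≡0 i j = begin
    c * Y i j + combination L i j
      ≡⟨ cong₂ _+_ (cong (_* Y i j) (proj₁ both)) (zero-weight⇒zero adm (proj₂ both) i j) ⟩
    0ℚ * Y i j + 0ℚ
      ≡⟨ trans (ℚP.+-identityʳ _) (ℚP.*-zeroˡ (Y i j)) ⟩
    0ℚ ∎
    where both = nonNeg-sum-zero c≥0 (weight-nonNeg adm) w≡0

  scale : ℚ → List (Term m n) → List (Term m n)
  scale k = mapL (λ t → k * proj₁ t , proj₂ t)

  weight-scale : ∀ k L → weight (scale k L) ≡ k * weight L
  weight-scale k []            = sym (ℚP.*-zeroʳ k)
  weight-scale k ((c , Y) ∷ L) =
    trans (cong (k * c +_) (weight-scale k L)) (sym (ℚP.*-distribˡ-+ k c (weight L)))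

  combination-scale : ∀ k L i j → combination (scale k L) i j ≡ k * combination L i j
  combination-scale k []            i j = sym (ℚP.*-zeroʳ k)
  combination-scale k ((c , Y) ∷ L) i j =
    trans (cong₂ _+_ (ℚP.*-assoc k c (Y i j)) (combination-scale k L i j))
          (sym (ℚP.*-distribˡ-+ k (c * Y i j) (combination L i j)))

  admissible-scale : ∀ {k L} → 0ℚ ≤ k → Admissible L → Admissible (scale k L)
  admissible-scale k≥0 []                   = []
  admissible-scale k≥0 ((c≥0 , Y∈S) ∷ adm) = (*-nonNeg k≥0 c≥0 , Y∈S) ∷ admissible-scale k≥0 adm

  rescale∈hull : ∀ {L} k → 0ℚ ≤ k → k * weight L ≡ 1ℚ → Admissible L →
    InConvexHull S (λ i j → k * combination L i j)
  rescale∈hull {L} k k≥0 kw≡1 adm =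
    combination⇒hull (scale k L) (admissible-scale k≥0 adm) (trans (weight-scale k L) kw≡1)
      (λ i j → sym (combination-scale k L i j))

  drop-null-term : ∀ {X c Y L} → c ≡ 0ℚ → c + weight L ≡ 1ℚ →
    X ≐ combination ((c , Y) ∷ L) → weight L ≡ 1ℚ × X ≐ combination L
  drop-null-term {X} {c} {Y} {L} refl w≡1 X≐ =
    trans (sym (ℚP.+-identityˡ (weight L))) w≡1 ,
    λ i j → begin
      X i j                           ≡⟨ X≐ i j ⟩
      0ℚ * Y i j + combination L i j  ≡⟨ cong (_+ combination L i j) (ℚP.*-zeroˡ (Y i j)) ⟩
      0ℚ + combination L i j          ≡⟨ ℚP.+-identityˡ _ ⟩
      combination L i j               ∎

  sole-term : ∀ {X c Y L} → Admissible L → c + weight L ≡ 1ℚ → weight L ≡ 0ℚ →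
    X ≐ combination ((c , Y) ∷ L) → X ≐ Y
  sole-term {X} {c} {Y} {L} adm w≡1 rest≡0 X≐ i j = begin
    X i j                          ≡⟨ X≐ i j ⟩
    c * Y i j + combination L i j  ≡⟨ cong₂ _+_ (cong (_* Y i j) c≡1) (zero-weight⇒zero adm rest≡0 i j) ⟩
    1ℚ * Y i j + 0ℚ                ≡⟨ trans (ℚP.+-identityʳ _) (ℚP.*-identityˡ (Y i j)) ⟩
    Y i j                          ∎
    where
    c≡1 : c ≡ 1ℚ
    c≡1 = trans (sym (ℚP.+-identityʳ c)) (trans (cong (c +_) (sym rest≡0)) w≡1)

  -- If a vertex is a combination c Y + (rest) with both parts of positive
  -- weight, it equals Y: it is the strict convex combination c Y + (1-c) Z
  -- of two hull points, Z being the renormalised rest.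
  vertex-split : ∀ {X c Y L} → IsVertex (InConvexHull S) X → S Y → Admissible L →
    0ℚ ℚ.< c → 0ℚ ℚ.< weight L → c + weight L ≡ 1ℚ →
    X ≐ combination ((c , Y) ∷ L) → X ≐ Y
  vertex-split {X} {c} {Y} {L} V Y∈S adm c>0 w>0 w≡1 X≐ i j = begin
    X i j                          ≡⟨ X≐ₜ i j ⟩
    c * Y i j + (1ℚ - c) * Z i j   ≡⟨ cong (λ z → c * Y i j + (1ℚ - c) * z) (sym (Y≐Z i j)) ⟩
    c * Y i j + (1ℚ - c) * Y i j   ≡⟨ affine c (Y i j) ⟩
    Y i j                          ∎
    where
    w = weight L
    instance
      w-pos : ℚ.Positive w
      w-pos = ℚ.positive w>0
      w≢0 : ℚ.NonZero w
      w≢0 = ℚP.pos⇒nonZero w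
    Z : Mat ℚ m n
    Z i j = 1/ w * combination L i j
    Z∈hull : InConvexHull S Z
    Z∈hull = rescale∈hull (1/ w) (ℚP.<⇒≤ (ℚP.positive⁻¹ (1/ w) {{ℚP.1/pos⇒pos w}}))
                          (ℚP.*-inverseˡ w) adm
    1-c≡w : 1ℚ - c ≡ w
    1-c≡w = trans (cong (_- c) (sym w≡1)) (cancel c w)
      where cancel = solve 2 (λ c w → (c :+ w) :- c := w) refl
    c<1 : c ℚ.< 1ℚ
    c<1 = subst₂ ℚ._<_ (ℚP.+-identityʳ c) w≡1 (ℚP.+-monoʳ-< c w>0)
    X≐ₜ : ∀ i j → X i j ≡ c * Y i j + (1ℚ - c) * Z i j
    X≐ₜ i j = trans (X≐ i j) (cong (c * Y i j +_) (sym (begin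
      (1ℚ - c) * (1/ w * combination L i j)  ≡⟨ cong (_* _) 1-c≡w ⟩
      w * (1/ w * combination L i j)         ≡⟨ sym (ℚP.*-assoc w (1/ w) _) ⟩
      (w * 1/ w) * combination L i j         ≡⟨ cong (_* combination L i j) (ℚP.*-inverseʳ w) ⟩
      1ℚ * combination L i j                 ≡⟨ ℚP.*-identityˡ _ ⟩
      combination L i j                      ∎)))
    Y≐Z : Y ≐ Z
    Y≐Z = proj₂ V Y Z c (member⇒hull Y∈S) Z∈hull c>0 c<1 X≐ₜ
    affine : ∀ c y → c * y + (1ℚ - c) * y ≡ y
    affine = solve 2 (λ c y → c :* y :+ (con 1ℚ :- c) :* y := y) refl

  vertex⇒member : (∀ {X Y} → X ≐ Y → S Y → S X) →
    ∀ {X} → IsVertex (InConvexHull S) X → S X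
  vertex⇒member closed {X} V with hull⇒combination (proj₁ V)
  ... | L , adm , w≡1 , X≐ = from-combination L adm w≡1 X≐
    where
    from-combination : ∀ L → Admissible L → weight L ≡ 1ℚ → X ≐ combination L → S X
    from-combination [] _ w≡1 _ = ⊥-elim (ℚP.1≢0 (sym w≡1))
    from-combination ((c , Y) ∷ L) ((c≥0 , Y∈S) ∷ adm) w≡1 X≐
      with nonNeg-cases c≥0 | nonNeg-cases (weight-nonNeg adm)
    ... | inj₁ c≡0 | _ =
      let (rest≡1 , X≐rest) = drop-null-term {c = c} {Y} {L} c≡0 w≡1 X≐
      in from-combination L adm rest≡1 X≐rest
    ... | inj₂ c>0 | inj₁ rest≡0 = closed (sole-term {c = c} {Y} adm w≡1 rest≡0 X≐) Y∈S
    ... | inj₂ c>0 | inj₂ rest>0 = closed (vertex-split {c = c} {Y} V Y∈S adm c>0 rest>0 w≡1 X≐) Y∈S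

  weightedSum : (Mat ℚ m n → ℚ) → List (Term m n) → ℚ
  weightedSum φ L = sumℚ (mapL (λ t → proj₁ t * φ (proj₂ t)) L)

  linear-combination : ∀ {φ} → IsLinear φ → ∀ L → φ (combination L) ≡ weightedSum φ L
  linear-combination φ-lin []            = IsLinear.zero-matrix φ-lin
  linear-combination {φ} φ-lin ((c , Y) ∷ L) = begin
    φ (combination ((c , Y) ∷ L))
      ≡⟨ respects-≐ (λ i j → cong (c * Y i j +_) (sym (ℚP.*-identityˡ _))) ⟩
    φ (λ i j → c * Y i j + 1ℚ * combination L i j)
      ≡⟨ linear c 1ℚ Y (combination L) ⟩
    c * φ Y + 1ℚ * φ (combination L)
      ≡⟨ cong (c * φ Y +_) (trans (ℚP.*-identityˡ _) (linear-combination φ-lin L)) ⟩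
    c * φ Y + weightedSum φ L ∎
    where open IsLinear φ-lin

  weightedSum-bounds : ∀ {φ} → (∀ {Y} → S Y → ZeroOne (φ Y)) →
    ∀ {L} → Admissible L → 0ℚ ≤ weightedSum φ L × weightedSum φ L ≤ weight L
  weightedSum-bounds φ∈01 []                     = ℚP.≤-refl , ℚP.≤-refl
  weightedSum-bounds φ∈01 ((c≥0 , Y∈S) ∷ adm) =
    +-nonNeg (proj₁ head) (proj₁ rest) , ℚP.+-mono-≤ (proj₂ head) (proj₂ rest)
    where
    head = scaled-zeroOne c≥0 (φ∈01 Y∈S)
    rest = weightedSum-bounds φ∈01 adm

  hull-bounds : ∀ {φ} → IsLinear φ → (∀ {Y} → S Y → ZeroOne (φ Y)) →
    ∀ {X} → InConvexHull S X → 0ℚ ≤ φ X × φ X ≤ 1ℚ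
  hull-bounds {φ} φ-lin φ∈01 X∈hull with hull⇒combination X∈hull
  ... | L , adm , w≡1 , X≐ =
    subst (0ℚ ≤_) (sym φX≡) (proj₁ bounds) , subst₂ _≤_ (sym φX≡) w≡1 (proj₂ bounds)
    where
    φX≡ = trans (IsLinear.respects-≐ φ-lin X≐) (linear-combination φ-lin L)
    bounds = weightedSum-bounds φ∈01 adm

  separating-zeroOne⇒vertex : {K : Set} (φ : K → Mat ℚ m n → ℚ) →
    (∀ k → IsLinear (φ k)) → (∀ k {Y} → S Y → ZeroOne (φ k Y)) →
    (∀ {Y Z} → (∀ k → φ k Y ≡ φ k Z) → Y ≐ Z) →
    ∀ {X} → S X → IsVertex (InConvexHull S) X
  separating-zeroOne⇒vertex φ φ-lin φ∈01 separates X∈S =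
    member⇒hull X∈S , λ Y Z t Y∈hull Z∈hull t>0 t<1 X≐ → separates λ k →
      zeroOne-extreme t>0 t<1 (hull-bounds (φ-lin k) (φ∈01 k) Y∈hull)
        (hull-bounds (φ-lin k) (φ∈01 k) Z∈hull) (φ∈01 k X∈S)
        (trans (IsLinear.respects-≐ (φ-lin k) X≐) (IsLinear.linear (φ-lin k) t (1ℚ - t) Y Z))

columnPrefix : ∀ {m n} → Fin m × Fin n → Mat ℚ m n → ℚ
columnPrefix (i , j) X = prefixSum (λ i′ → X i′ j) (suc (toℕ i))

columnPrefix-linear : ∀ {m n} (k : Fin m × Fin n) → IsLinear (columnPrefix k)
columnPrefix-linear (i , j) = record
  { respects-≐ = λ X≐Y → prefixSum-cong (λ i′ → X≐Y i′ j) (suc (toℕ i))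
  ; linear     = λ a b X Y → prefixSum-linear a b (λ i′ → X i′ j) (λ i′ → Y i′ j) (suc (toℕ i))
  }

columnPrefixes-separate : ∀ {m n} {Y Z : Mat ℚ m n} →
  (∀ k → columnPrefix k Y ≡ columnPrefix k Z) → Y ≐ Z
columnPrefixes-separate {Y = Y} {Z} same i j =
  prefixSums-determine (λ i′ → Y i′ j) (λ i′ → Z i′ j) (λ i′ → same (i′ , j)) i

signMatrix-columnPrefix : ∀ {m n} {A : Mat ℤ m n} → IsSignMatrix A →
  ∀ k → ZeroOne (columnPrefix k (toℚMat A))
signMatrix-columnPrefix {A = A} (_ , columns , _) (i , j) =
  Sum.map embed embed (columns i j)
  where
  embed : ∀ {z} → sumFirst (λ i′ → A i′ j) (suc (toℕ i)) ≡ z →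
    columnPrefix (i , j) (toℚMat A) ≡ z / 1
  embed s≡z = trans (prefixSum-/1 (λ i′ → A i′ j) (suc (toℕ i))) (cong (_/ 1) s≡z)

MSet-closed : ∀ {λs n} {X Y : Mat ℚ (largestPart λs) n} →
  X ≐ Y → MSet λs n Y → MSet λs n X
MSet-closed X≐Y (A , A∈M , Y≐A) = A , A∈M , λ i j → trans (X≐Y i j) (Y≐A i j)

MSet-columnPrefix : ∀ {λs n} k {X : Mat ℚ (largestPart λs) n} →
  MSet λs n X → ZeroOne (columnPrefix k X)
MSet-columnPrefix k (A , (sign , _) , X≐A) =
  subst ZeroOne (sym (IsLinear.respects-≐ (columnPrefix-linear k) X≐A))
        (signMatrix-columnPrefix sign k)

theorem3p6 : (λs : List ℕ) → IsPartition λs → (n : ℕ) → 0 < n →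
    (X : Mat ℚ (largestPart λs) n) →
      (IsVertex (P λs n) X → MSet λs n X) × (MSet λs n X → IsVertex (P λs n) X)
theorem3p6 λs _ n _ X =
    vertex⇒member (MSet-closed {λs})
  , separating-zeroOne⇒vertex columnPrefix columnPrefix-linear
      (λ k → MSet-columnPrefix {λs} k) columnPrefixes-separate
  where open ConvexHull (MSet λs n)
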